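{- Let $G=(V,E)$ be a finite, connected, undirected, unweighted graph with shortest-path distance $d$. Under distributed embedding (a set of landmarks $\mathbf{L}\subseteq V$ and an assignment $\lambda:V\to\mathbf{L}$ of each vertex to a landmark), the dual landmark heuristic $\pi_t^{DL}$ is not consistent: consistency $\pi_t^{DL}(v)\le c(v,v')+\pi_t^{DL}(v')$ for every edge $(v,v')\in E$, where $c(v,v')$ is the cost of the edge, does not hold in general.
   Context: Distributed embedding: a set of landmark vertices $\mathbf{L}\subseteq V$ is chosen and the vertex set is partitioned so that every vertex $v$ is assigned to exactly one landmark $\lambda(v)\in\mathbf{L}$; only the distances $d(v,\lambda(v))$ for each $v$ and the pairwise distances $d(l,l')$ for $l,l'\in\mathbf{L}$ are stored. For a target $t$ and visited vertex $v$, put $l_1=\lambda(v)$ and $l_2=\lambda(t)$, and define $\pi_t^{DL}(v,1)=|d(v,l_1)-d(l_1,l_2)|-d(l_2,t)$, $\pi_t^{DL}(v,2)=|d(v,l_1)-d(l_2,t)|-d(l_1,l_2)$, $\pi_t^{DL}(v,3)=|d(l_1,l_2)-d(l_2,t)|-d(v,l_1)$, $\pi_t^{DL}(v,6)=\dfrac{|d(v,l_1)-d(l_1,l_2)|\cdot|d(l_1,l_2)-d(l_2,t)|-d(v,l_1)\cdot d(l_2,t)}{d(l_1,l_2)}$ (only when $l_1\neq l_2$), and, only when $l_1=l_2$, $\pi_t^{DL}(v,4)=|d(v,l_1)-d(l_1,t)|$ and $\pi_t^{DL}(v,5)=|d(v,l_2)-d(l_2,t)|$. The heuristic is $\pi_t^{DL}(v)=\max_i\pi_t^{DL}(v,i)$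 over the defined terms. A heuristic $h$ is consistent (monotone) if $h(v)\le c(v,v')+h(v')$ for every edge $(v,v')$, where $c(v,v')\ge 0$ is the transition cost (here $1$, as the graph is unweighted). -}

module Defs where

open import Data.Nat as ℕ using (ℕ; zero; suc)
open import Data.Integer using (+_)
open import Data.Fin using (Fin; _≟_)
open import Data.Bool using (Bool; false; T)
open import Data.Product using (∃; _×_)
open import Data.Rational using (ℚ; _/_; _-_; _*_; _⊔_; ∣_∣; 0ℚ)
open import Relation.Binary.PropositionalEquality using (_≡_)
open import Relation.Nullary using (yes; no)

record SimpleGraph (n : ℕ) : Set where
  field
    Adj    : Fin n → Fin n → Bool
    sym    : ∀ u v → Adj u v ≡ Adj v u
    irrefl : ∀ v → Adj v v ≡ false

open SimpleGraph public

Edge : ∀ {n} → SimpleGraph n → Fin n → Fin n → Set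
Edge G u v = T (Adj G u v)

data Walk {n : ℕ} (G : SimpleGraph n) : Fin n → Fin n → ℕ → Set where
  nil  : ∀ {u} → Walk G u u 0
  cons : ∀ {u w v k} → Edge G u w → Walk G w v k → Walk G u v (suc k)

Connected : ∀ {n} → SimpleGraph n → Set
Connected G = ∀ u v → ∃ λ k → Walk G u v k

IsShortestPathDist : ∀ {n} → SimpleGraph n → (Fin n → Fin n → ℕ) → Set
IsShortestPathDist G d =
  ∀ u v → Walk G u v (d u v) × (∀ k → Walk G u v k → d u v ℕ.≤ k)

ℕ→ℚ : ℕ → ℚ
ℕ→ℚ k = + k / 1

-- x / k (the k = 0 case never arises: only used when l₁ ≠ l₂ in a connected graph)
divℕ : ℚ → ℕ → ℚ
divℕ x zero    = 0ℚ
divℕ x (suc k) = x * (+ 1 / suc k)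

πDL : ∀ {n} → (d : Fin n → Fin n → ℕ) → (lam : Fin n → Fin n)
    → (t v : Fin n) → ℚ
πDL d lam t v with lam v ≟ lam t
... | yes _ = t1 ⊔ t2 ⊔ t3 ⊔ t4 ⊔ t5
  where
    l₁ = lam v
    l₂ = lam t
    a = ℕ→ℚ (d v l₁)
    b = ℕ→ℚ (d l₁ l₂)
    c = ℕ→ℚ (d l₂ t)
    t1 = ∣ a - b ∣ - c
    t2 = ∣ a - c ∣ - b
    t3 = ∣ b - c ∣ - a
    t4 = ∣ a - ℕ→ℚ (d l₁ t) ∣
    t5 = ∣ ℕ→ℚ (d v l₂) - c ∣
... | no _ = t1 ⊔ t2 ⊔ t3 ⊔ t6
  where
    l₁ = lam v
    l₂ = lam t
    a = ℕ→ℚ (d v l₁)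
    b = ℕ→ℚ (d l₁ l₂)
    c = ℕ→ℚ (d l₂ t)
    t1 = ∣ a - b ∣ - c
    t2 = ∣ a - c ∣ - b
    t3 = ∣ b - c ∣ - a
    t6 = divℕ (∣ a - b ∣ * ∣ b - c ∣ - a * c) (d l₁ l₂)

-- A counterexample on the path 0 — 1 — 2 with landmarks {0, 2}, target t = 2,
-- and vertex 1 assigned to the far landmark 2 while 0 and 2 use landmark 0.
-- At v = 0 the target shares v's landmark, so the exact term |d(v,l) − d(l,t)|
-- yields π(0) = d(0,2) = 2; at the neighbour v′ = 1 every term is −1, because
-- only the detour 1 → 2 → 0 → 2 is visible.  Across one edge of cost 1 the
-- heuristic drops by 3.
module Submission where

open import Defs
open import Data.Nat using (ℕ; _≤_; z≤n; s≤s)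
open import Data.Nat.Properties using (≤-reflexive; ≤-trans)
open import Data.Fin using (Fin; zero; suc)
open import Data.Fin.Subset using (Subset; _∈_; inside; outside)
open import Data.Vec using (_∷_; [])
open import Data.Vec.Base using (here; there)
open import Data.Bool using (Bool; true; false)
open import Data.Unit using (tt)
open import Data.Product using (Σ; _×_; _,_; proj₁)
open import Data.Rational using (_<_; _+_; -_; 1ℚ; _<?_)
open import Relation.Binary.PropositionalEquality using (_≡_; refl)
open import Relation.Nullary.Decidable using (toWitness)

shortestPathDist⇒connected : ∀ {n} {G : SimpleGraph n} {d : Fin n → Fin n → ℕ} →
                             IsShortestPathDist G d → Connected G
shortestPathDist⇒connected {d = d} isDist u v = d u v , proj₁ (isDist u v)

diameter≤2⇒walk-length-lower-bound :
  ∀ {n} {G : SimpleGraph n} (d : Fin n → Fin n → ℕ) →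
  (∀ u → d u u ≡ 0) → (∀ u v → Edge G u v → d u v ≡ 1) → (∀ u v → d u v ≤ 2) →
  ∀ {u v k} → Walk G u v k → d u v ≤ k
diameter≤2⇒walk-length-lower-bound d diag edge diam {u} nil = ≤-reflexive (diag u)
diameter≤2⇒walk-length-lower-bound d diag edge diam {u} {v} (cons e nil) =
  ≤-reflexive (edge u v e)
diameter≤2⇒walk-length-lower-bound d diag edge diam {u} {v} (cons _ (cons _ _)) =
  ≤-trans (diam u v) (s≤s (s≤s z≤n))

pattern v₀ = zero
pattern v₁ = suc zero
pattern v₂ = suc (suc zero)

pathAdj : Fin 3 → Fin 3 → Bool
pathAdj v₀ v₁ = true
pathAdj v₁ v₀ = true
pathAdj v₁ v₂ = true
pathAdj v₂ v₁ = true
pathAdj _  _  = false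

pathAdj-sym : ∀ u v → pathAdj u v ≡ pathAdj v u
pathAdj-sym v₀ v₀ = refl
pathAdj-sym v₀ v₁ = refl
pathAdj-sym v₀ v₂ = refl
pathAdj-sym v₁ v₀ = refl
pathAdj-sym v₁ v₁ = refl
pathAdj-sym v₁ v₂ = refl
pathAdj-sym v₂ v₀ = refl
pathAdj-sym v₂ v₁ = refl
pathAdj-sym v₂ v₂ = refl

pathAdj-irrefl : ∀ v → pathAdj v v ≡ false
pathAdj-irrefl v₀ = refl
pathAdj-irrefl v₁ = refl
pathAdj-irrefl v₂ = refl

P₃ : SimpleGraph 3
P₃ = record { Adj = pathAdj ; sym = pathAdj-sym ; irrefl = pathAdj-irrefl }

pathDist : Fin 3 → Fin 3 → ℕ
pathDist v₀ v₀ = 0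
pathDist v₀ v₁ = 1
pathDist v₀ v₂ = 2
pathDist v₁ v₀ = 1
pathDist v₁ v₁ = 0
pathDist v₁ v₂ = 1
pathDist v₂ v₀ = 2
pathDist v₂ v₁ = 1
pathDist v₂ v₂ = 0

pathDist-walk : ∀ u v → Walk P₃ u v (pathDist u v)
pathDist-walk v₀ v₀ = nil
pathDist-walk v₀ v₁ = cons tt nil
pathDist-walk v₀ v₂ = cons {w = v₁} tt (cons tt nil)
pathDist-walk v₁ v₀ = cons tt nil
pathDist-walk v₁ v₁ = nil
pathDist-walk v₁ v₂ = cons tt nil
pathDist-walk v₂ v₀ = cons {w = v₁} tt (cons tt nil)
pathDist-walk v₂ v₁ = cons tt nil
pathDist-walk v₂ v₂ = nil

pathDist-diag : ∀ u → pathDist u u ≡ 0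
pathDist-diag v₀ = refl
pathDist-diag v₁ = refl
pathDist-diag v₂ = refl

pathDist-edge : ∀ u v → Edge P₃ u v → pathDist u v ≡ 1
pathDist-edge v₀ v₁ _ = refl
pathDist-edge v₁ v₀ _ = refl
pathDist-edge v₁ v₂ _ = refl
pathDist-edge v₂ v₁ _ = refl
pathDist-edge v₀ v₀ ()
pathDist-edge v₀ v₂ ()
pathDist-edge v₁ v₁ ()
pathDist-edge v₂ v₀ ()
pathDist-edge v₂ v₂ ()

pathDist≤2 : ∀ u v → pathDist u v ≤ 2
pathDist≤2 v₀ v₀ = z≤n
pathDist≤2 v₀ v₁ = s≤s z≤n
pathDist≤2 v₀ v₂ = s≤s (s≤s z≤n)
pathDist≤2 v₁ v₀ = s≤s z≤n
pathDist≤2 v₁ v₁ = z≤n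
pathDist≤2 v₁ v₂ = s≤s z≤n
pathDist≤2 v₂ v₀ = s≤s (s≤s z≤n)
pathDist≤2 v₂ v₁ = s≤s z≤n
pathDist≤2 v₂ v₂ = z≤n

pathDist-isShortestPathDist : IsShortestPathDist P₃ pathDist
pathDist-isShortestPathDist u v =
  pathDist-walk u v ,
  λ k → diameter≤2⇒walk-length-lower-bound pathDist pathDist-diag pathDist-edge pathDist≤2

landmarks : Subset 3
landmarks = inside ∷ outside ∷ inside ∷ []

assign : Fin 3 → Fin 3
assign v₀ = v₀
assign v₁ = v₂
assign v₂ = v₀

assign∈landmarks : ∀ v → assign v ∈ landmarks
assign∈landmarks v₀ = here
assign∈landmarks v₁ = there (there here)
assign∈landmarks v₂ = here

πDL-at-v₀ : πDL pathDist assign v₂ v₀ ≡ ℕ→ℚ 2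
πDL-at-v₀ = refl

πDL-at-v₁ : πDL pathDist assign v₂ v₁ ≡ - 1ℚ
πDL-at-v₁ = refl

theorem2 : Σ ℕ λ n → Σ (SimpleGraph n) λ G → Connected G
    × Σ (Fin n → Fin n → ℕ) λ d → IsShortestPathDist G d
    × Σ (Subset n) λ L → Σ (Fin n → Fin n) λ lam → (∀ v → lam v ∈ L)
    × Σ (Fin n) λ t → Σ (Fin n) λ v → Σ (Fin n) λ v′ → Edge G v v′
    × (1ℚ + πDL d lam t v′ < πDL d lam t v)
theorem2 =
  3 , P₃ , shortestPathDist⇒connected pathDist-isShortestPathDist ,
  pathDist , pathDist-isShortestPathDist ,
  landmarks , assign , assign∈landmarks ,
  v₂ , v₀ , v₁ , tt , inconsistency
  where
    inconsistency : 1ℚ + πDL pathDist assign v₂ v₁ < πDL pathDist assign v₂ v₀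
    inconsistency rewrite πDL-at-v₀ | πDL-at-v₁ = toWitness {a? = _ <? _} tt
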